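{- Let $G$ be a connected bipartite graph and let $k$ be a positive integer. Then $min_k(G\times K_2)=2\,min_k(G)$ and $min_D(G\times K_2)=2\,min_D(G)$.
   Context: All graphs are finite and simple. $K_2$ is the complete graph on two vertices. The tensor product $G\times H$ has vertex set $V(G)\times V(H)$. In it, $(u,u')$ and $(v,v')$ are adjacent if and only if $uv\in E(G)$ and $u'v'\in E(H)$. $k$-threshold process: every vertex is black or white at each discrete time step $t=0,1,2,\ldots$. A black vertex stays black forever. A white vertex becomes black at time $t$ if at least $k$ of its neighbors are black at time $t-1$. A $k$-conversion set is an initial black set that eventually makes every vertex black. $min_k(G)$ is the minimum size of a $k$-conversion set of $G$. Majority process: a black vertex stays black forever. A white vertex $v$ with $\deg(v)\geq 1$ becomes black at time $t$ if at least $\deg(v)/2$ of its neighbors are black at time $t-1$. An isolated vertex never changes color. A dynamo is an initial black set that eventually makes every vertex black. $min_D(G)$ is the minimum size of a dynamo of $G$. -}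

module Defs where

open import Data.Nat using (ℕ; zero; suc; _*_; _≤_; _≤ᵇ_)
open import Data.Bool using (Bool; true; false; _∧_; _∨_)
open import Data.Bool.Properties using (∧-zeroʳ)
open import Data.Fin using (Fin; zero; suc; remQuot; _≟_)
open import Data.Fin.Subset using (Subset; ⊤; _∩_; ∣_∣)
open import Data.Vec using (tabulate; lookup)
open import Data.Product using (Σ; ∃; _×_; _,_; proj₁; proj₂)
open import Relation.Nullary using (¬_; does)
open import Relation.Binary.PropositionalEquality using (_≡_; _≢_; refl; cong₂)

record Graph : Set where
  field
    n      : ℕ
    adj    : Fin n → Fin n → Bool
    sym    : ∀ u v → adj u v ≡ adj v u
    irrefl : ∀ v → adj v v ≡ false
open Graph public

K₂ : Graph
K₂ = record
  { n = 2
  ; adj = λ u v → not' (does (u ≟ v))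
  ; sym = symK
  ; irrefl = irrK }
  where
  not' : Bool → Bool
  not' true = false
  not' false = true
  symK : ∀ (u v : Fin 2) → not' (does (u ≟ v)) ≡ not' (does (v ≟ u))
  symK zero zero = refl
  symK zero (suc zero) = refl
  symK (suc zero) zero = refl
  symK (suc zero) (suc zero) = refl
  irrK : ∀ (v : Fin 2) → not' (does (v ≟ v)) ≡ false
  irrK zero = refl
  irrK (suc zero) = refl

-- Tensor product G × H: vertex set Fin (n G * n H) ≅ Fin (n G) × Fin (n H)
-- via remQuot (inverse of Data.Fin.combine).
_⊗_ : Graph → Graph → Graph
G ⊗ H = record
  { n = n G * n H
  ; adj = A
  ; sym = λ x y → cong₂ _∧_ (sym G (π₁ x) (π₁ y)) (sym H (π₂ x) (π₂ y))
  ; irrefl = irr }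
  where
  π₁ : Fin (n G * n H) → Fin (n G)
  π₁ x = proj₁ (remQuot {n G} (n H) x)
  π₂ : Fin (n G * n H) → Fin (n H)
  π₂ x = proj₂ (remQuot {n G} (n H) x)
  A : Fin (n G * n H) → Fin (n G * n H) → Bool
  A x y = adj G (π₁ x) (π₁ y) ∧ adj H (π₂ x) (π₂ y)
  irr : ∀ x → A x x ≡ false
  irr x rewrite irrefl G (π₁ x) = refl

data Reach (G : Graph) : Fin (n G) → Fin (n G) → Set where
  here : ∀ {v} → Reach G v v
  step : ∀ {u w v} → adj G u w ≡ true → Reach G w v → Reach G u v

Connected : Graph → Set
Connected G = ∀ u v → Reach G u v

Bipartite : Graph → Set
Bipartite G = Σ (Fin (n G) → Bool) λ c → ∀ u v → adj G u v ≡ true → c u ≢ c v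

N : (G : Graph) → Fin (n G) → Subset (n G)
N G v = tabulate (adj G v)

deg : (G : Graph) → Fin (n G) → ℕ
deg G v = ∣ N G v ∣

-- number of black neighbours of v in the colouring S (S = set of black vertices)
blackNbrs : (G : Graph) → Subset (n G) → Fin (n G) → ℕ
blackNbrs G S v = ∣ N G v ∩ S ∣

kStep : ℕ → (G : Graph) → Subset (n G) → Subset (n G)
kStep k G S = tabulate λ v → lookup S v ∨ (k ≤ᵇ blackNbrs G S v)

-- one step of the majority process: white v with deg v ≥ 1 turns black
-- iff (#black nbrs) ≥ deg v / 2, i.e. deg v ≤ 2 * #black nbrs
majStep : (G : Graph) → Subset (n G) → Subset (n G)
majStep G S = tabulate λ v →
  lookup S v ∨ ((1 ≤ᵇ deg G v) ∧ (deg G v ≤ᵇ 2 * blackNbrs G S v))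

iter : ∀ {A : Set} → (A → A) → ℕ → A → A
iter f zero a = a
iter f (suc t) a = f (iter f t a)

IsConversionSet : ℕ → (G : Graph) → Subset (n G) → Set
IsConversionSet k G S = ∃ λ t → iter (kStep k G) t S ≡ ⊤

IsDynamo : (G : Graph) → Subset (n G) → Set
IsDynamo G S = ∃ λ t → iter (majStep G) t S ≡ ⊤

IsMinSize : ∀ {n} → (Subset n → Set) → ℕ → Set
IsMinSize {n} P m = (Σ (Subset n) λ S → P S × ∣ S ∣ ≡ m) × (∀ S → P S → m ≤ ∣ S ∣)

Min-k : ℕ → (G : Graph) → ℕ → Set
Min-k k G m = IsMinSize (IsConversionSet k G) m

Min-D : (G : Graph) → ℕ → Set
Min-D G m = IsMinSize (IsDynamo G) m

-- The tensor product G × K₂ of a bipartite graph G with a proper 2-colouring c is the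
-- disjoint union of two copies of G, the "sheets" {(u, c u)} and {(u, ¬ c u)}: a vertex
-- (u, c u) has exactly the neighbours (v, c v) with uv an edge of G. Both processes decide
-- the colour of a vertex from its degree and its number of black neighbours only, so they
-- run independently on the two sheets, each a copy of the process on G. Hence S converts
-- G × K₂ iff both restrictions of S convert G, which gives min(G × K₂) = 2 min(G).
module Submission where

open import Defs hiding (sym)
open import Data.Bool using (Bool; true; false; not; _∧_; _∨_)
open import Data.Bool.Properties using (¬-not; not-injective)
open import Data.Fin using (Fin; zero; suc; combine; quotient; _↑ˡ_; _↑ʳ_)
open import Data.Fin.Properties using (remQuot-combine)
open import Data.Fin.Subset using (Subset; ⊤; _∩_; ∣_∣)
open import Data.Fin.Subset.Properties using (∣⊤∣≡n; ∣p∣≡n⇒p≡⊤; ∩-identityʳ)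
open import Data.Nat using (ℕ; zero; suc; _+_; _*_; _≤_; _≤ᵇ_)
open import Data.Nat.Properties
  using (+-0-commutativeMonoid; +-assoc; +-comm; +-identityʳ; *-comm; +-mono-≤)
open import Algebra.Properties.CommutativeMonoid.Sum +-0-commutativeMonoid
  using (sum; sum-syntax; sum-cong-≗; ∑-distrib-+)
open import Data.Product using (∃; _×_; _,_; proj₁; proj₂)
open import Data.Vec using ([]; _∷_; tabulate; lookup)
open import Data.Vec.Functional using (Vector)
open import Data.Vec.Properties
  using (lookup∘tabulate; tabulate-cong; tabulate∘lookup; lookup-zipWith; lookup-replicate)
open import Function using (_∘_)
open import Relation.Binary.PropositionalEquality
open ≡-Reasoning

indicator : Bool → ℕ
indicator false = 0
indicator true  = 1

count : ∀ {m} → (Fin m → Bool) → ℕ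
count f = sum (indicator ∘ f)

∣p∣≡count-lookup : ∀ {m} (p : Subset m) → ∣ p ∣ ≡ count (lookup p)
∣p∣≡count-lookup []          = refl
∣p∣≡count-lookup (true ∷ p)  = cong suc (∣p∣≡count-lookup p)
∣p∣≡count-lookup (false ∷ p) = ∣p∣≡count-lookup p

∣tabulate∩∣≡count : ∀ {m} (f : Fin m → Bool) (p : Subset m) →
                    ∣ tabulate f ∩ p ∣ ≡ count (λ i → f i ∧ lookup p i)
∣tabulate∩∣≡count f p = trans (∣p∣≡count-lookup (tabulate f ∩ p)) (sum-cong-≗ λ i →
  cong indicator (trans (lookup-zipWith _∧_ i (tabulate f) p)
                        (cong (_∧ lookup p i) (lookup∘tabulate f i))))

sum-↑ : ∀ a b (h : Vector ℕ (a + b)) → sum h ≡ sum (h ∘ (_↑ˡ b)) + sum (h ∘ (a ↑ʳ_))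
sum-↑ zero    b h = refl
sum-↑ (suc a) b h = trans (cong (h zero +_) (sum-↑ a b (h ∘ suc))) (sym (+-assoc (h zero) _ _))

sum-combine : ∀ m k (h : Vector ℕ (m * k)) → sum h ≡ ∑[ i < m ] ∑[ j < k ] h (combine i j)
sum-combine zero    k h = refl
sum-combine (suc m) k h =
  trans (sum-↑ k (m * k) h) (cong (sum (h ∘ (_↑ˡ m * k)) +_) (sum-combine m k (h ∘ (k ↑ʳ_))))

side : Bool → Fin 2
side false = zero
side true  = suc zero

sum-sides : ∀ (h : Vector ℕ 2) b → sum h ≡ h (side b) + h (side (not b))
sum-sides h false = cong (h zero +_) (+-identityʳ _)
sum-sides h true  = trans (cong (h zero +_) (+-identityʳ _)) (+-comm (h zero) _)

n+n≡2*n : ∀ n → n + n ≡ 2 * n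
n+n≡2*n n = cong (n +_) (sym (+-identityʳ n))

LocalRule : Set
LocalRule = ℕ → ℕ → Bool

-- kStep k and majStep are, definitionally, localStep for the rules λ _ b → k ≤ᵇ b and
-- λ d b → (1 ≤ᵇ d) ∧ (d ≤ᵇ 2 * b).
localStep : LocalRule → (G : Graph) → Subset (n G) → Subset (n G)
localStep P G S = tabulate λ v → lookup S v ∨ P (deg G v) (blackNbrs G S v)

Converts : LocalRule → (G : Graph) → Subset (n G) → Set
Converts P G S = ∃ λ t → iter (localStep P G) t S ≡ ⊤

IsProperColouring : (G : Graph) → (Fin (n G) → Bool) → Set
IsProperColouring G c = ∀ u v → adj G u v ≡ true → c u ≢ c v

module _ (G : Graph) where

  IsProperColouring-not : ∀ {c} → IsProperColouring G c → IsProperColouring G (not ∘ c)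
  IsProperColouring-not proper u v e = proper u v e ∘ not-injective

  vtx : Fin (n G) → Fin 2 → Fin (n (G ⊗ K₂))
  vtx = combine

  adj-vtx : ∀ u i v j → adj (G ⊗ K₂) (vtx u i) (vtx v j) ≡ adj G u v ∧ adj K₂ i j
  adj-vtx u i v j = cong₂ (λ p q → adj G (proj₁ p) (proj₁ q) ∧ adj K₂ (proj₂ p) (proj₂ q))
                          (remQuot-combine u i) (remQuot-combine v j)

  count-nbrs-vtx : ∀ u b (g : Fin (n (G ⊗ K₂)) → Bool) →
                   count (λ y → adj (G ⊗ K₂) (vtx u (side b)) y ∧ g y) ≡
                   count (λ v → adj G u v ∧ g (vtx v (side (not b))))
  count-nbrs-vtx u b g = trans (sum-combine (n G) 2 _) (sum-cong-≗ λ v →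
    trans (sum-cong-≗ λ j → cong (λ a → indicator (a ∧ g (vtx v j))) (adj-vtx u (side b) v j))
          (count-K₂-nbrs (adj G u v) b (g ∘ vtx v)))
    where
    count-K₂-nbrs : ∀ a b (h : Fin 2 → Bool) →
                    ∑[ j < 2 ] indicator ((a ∧ adj K₂ (side b) j) ∧ h j) ≡
                    indicator (a ∧ h (side (not b)))
    count-K₂-nbrs false false h = refl
    count-K₂-nbrs false true  h = refl
    count-K₂-nbrs true  false h = +-identityʳ _
    count-K₂-nbrs true  true  h = +-identityʳ _

  onSheet : (Fin (n G) → Bool) → Fin (n G) → Fin (n (G ⊗ K₂))
  onSheet c u = vtx u (side (c u))

  restrict : (Fin (n G) → Bool) → Subset (n (G ⊗ K₂)) → Subset (n G)
  restrict c S = tabulate (lookup S ∘ onSheet c)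

  lookup-restrict : ∀ c S u → lookup (restrict c S) u ≡ lookup S (onSheet c u)
  lookup-restrict c S = lookup∘tabulate _

  restrict-⊤ : ∀ c → restrict c ⊤ ≡ ⊤
  restrict-⊤ c = trans
    (tabulate-cong λ u →
      trans (lookup-replicate (onSheet c u) true) (sym (lookup-replicate u true)))
    (tabulate∘lookup ⊤)

  ∣restrict∣ : ∀ c S → ∣ restrict c S ∣ ≡ count (lookup S ∘ onSheet c)
  ∣restrict∣ c S =
    trans (∣p∣≡count-lookup (restrict c S)) (sum-cong-≗ (cong indicator ∘ lookup-restrict c S))

  ∣p∣≡∣restrict∣+∣restrict-not∣ : ∀ c S → ∣ S ∣ ≡ ∣ restrict c S ∣ + ∣ restrict (not ∘ c) S ∣
  ∣p∣≡∣restrict∣+∣restrict-not∣ c S = begin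
    ∣ S ∣
      ≡⟨ ∣p∣≡count-lookup S ⟩
    count (lookup S)
      ≡⟨ sum-combine (n G) 2 _ ⟩
    ∑[ u < n G ] ∑[ j < 2 ] black (vtx u j)
      ≡⟨ sum-cong-≗ (λ u → sum-sides (black ∘ vtx u) (c u)) ⟩
    ∑[ u < n G ] (black (onSheet c u) + black (onSheet (not ∘ c) u))
      ≡⟨ ∑-distrib-+ (black ∘ onSheet c) _ ⟩
    sum (black ∘ onSheet c) + sum (black ∘ onSheet (not ∘ c))
      ≡⟨ cong₂ _+_ (∣restrict∣ c S) (∣restrict∣ (not ∘ c) S) ⟨
    ∣ restrict c S ∣ + ∣ restrict (not ∘ c) S ∣ ∎
    where
    black : Fin (n (G ⊗ K₂)) → ℕ
    black = indicator ∘ lookup S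

  restrict-both-⊤⇒≡⊤ : ∀ c S → restrict c S ≡ ⊤ → restrict (not ∘ c) S ≡ ⊤ → S ≡ ⊤
  restrict-both-⊤⇒≡⊤ c S full full-not = ∣p∣≡n⇒p≡⊤ (begin
    ∣ S ∣                                       ≡⟨ ∣p∣≡∣restrict∣+∣restrict-not∣ c S ⟩
    ∣ restrict c S ∣ + ∣ restrict (not ∘ c) S ∣ ≡⟨ cong₂ _+_ (∣⊤∣ full) (∣⊤∣ full-not) ⟩
    n G + n G                                   ≡⟨ n+n≡2*n (n G) ⟩
    2 * n G                                     ≡⟨ *-comm 2 (n G) ⟩
    n G * 2                                     ∎)
    where
    ∣⊤∣ : ∀ {X} → X ≡ ⊤ → ∣ X ∣ ≡ n G
    ∣⊤∣ refl = ∣⊤∣≡n (n G)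

  lift : Subset (n G) → Subset (n (G ⊗ K₂))
  lift X = tabulate (lookup X ∘ quotient 2)

  restrict-lift : ∀ c X → restrict c (lift X) ≡ X
  restrict-lift c X = trans (tabulate-cong λ u →
      trans (lookup∘tabulate _ (onSheet c u))
            (cong (lookup X ∘ proj₁) (remQuot-combine u (side (c u)))))
    (tabulate∘lookup X)

  ∣lift∣ : ∀ X → ∣ lift X ∣ ≡ ∣ X ∣ + ∣ X ∣
  ∣lift∣ X = trans (∣p∣≡∣restrict∣+∣restrict-not∣ c (lift X))
                   (cong₂ _+_ (cong ∣_∣ (restrict-lift c X)) (cong ∣_∣ (restrict-lift (not ∘ c) X)))
    where
    c : Fin (n G) → Bool
    c _ = false

  module _ {c : Fin (n G) → Bool} (proper : IsProperColouring G c) where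

    blackNbrs-restrict : ∀ S u →
                         blackNbrs (G ⊗ K₂) S (onSheet c u) ≡ blackNbrs G (restrict c S) u
    blackNbrs-restrict S u = begin
      blackNbrs (G ⊗ K₂) S (onSheet c u)
        ≡⟨ ∣tabulate∩∣≡count _ S ⟩
      count (λ y → adj (G ⊗ K₂) (onSheet c u) y ∧ lookup S y)
        ≡⟨ count-nbrs-vtx u (c u) (lookup S) ⟩
      count (λ v → adj G u v ∧ lookup S (vtx v (side (not (c u)))))
        ≡⟨ sum-cong-≗ (cong indicator ∘ same-sheet) ⟩
      count (λ v → adj G u v ∧ lookup (restrict c S) v)
        ≡⟨ ∣tabulate∩∣≡count _ (restrict c S) ⟨
      blackNbrs G (restrict c S) u ∎
      where
      same-sheet : ∀ v → adj G u v ∧ lookup S (vtx v (side (not (c u)))) ≡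
                         adj G u v ∧ lookup (restrict c S) v
      same-sheet v with adj G u v in uv
      ... | false = refl
      ... | true  = trans (cong (λ b → lookup S (vtx v (side b))) (sym c-v≡not-c-u))
                          (sym (lookup-restrict c S v))
        where
        c-v≡not-c-u : c v ≡ not (c u)
        c-v≡not-c-u = ¬-not (≢-sym (proper u v uv))

    deg-restrict : ∀ u → deg (G ⊗ K₂) (onSheet c u) ≡ deg G u
    deg-restrict u = begin
      deg (G ⊗ K₂) (onSheet c u)         ≡⟨ cong ∣_∣ (∩-identityʳ (N (G ⊗ K₂) (onSheet c u))) ⟨
      blackNbrs (G ⊗ K₂) ⊤ (onSheet c u) ≡⟨ blackNbrs-restrict ⊤ u ⟩
      blackNbrs G (restrict c ⊤) u       ≡⟨ cong (λ S → blackNbrs G S u) (restrict-⊤ c) ⟩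
      blackNbrs G ⊤ u                    ≡⟨ cong ∣_∣ (∩-identityʳ (N G u)) ⟩
      deg G u                            ∎

    restrict-localStep : ∀ P S →
                         restrict c (localStep P (G ⊗ K₂) S) ≡ localStep P G (restrict c S)
    restrict-localStep P S = tabulate-cong λ u → let x = onSheet c u in begin
      lookup (localStep P (G ⊗ K₂) S) x
        ≡⟨ lookup∘tabulate _ x ⟩
      lookup S x ∨ P (deg (G ⊗ K₂) x) (blackNbrs (G ⊗ K₂) S x)
        ≡⟨ cong₂ (λ d b → lookup S x ∨ P d b) (deg-restrict u) (blackNbrs-restrict S u) ⟩
      lookup S x ∨ P (deg G u) (blackNbrs G (restrict c S) u)
        ≡⟨ cong (_∨ P (deg G u) (blackNbrs G (restrict c S) u)) (lookup-restrict c S u) ⟨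
      lookup (restrict c S) u ∨ P (deg G u) (blackNbrs G (restrict c S) u) ∎

    restrict-iter : ∀ P t S →
                    restrict c (iter (localStep P (G ⊗ K₂)) t S) ≡ iter (localStep P G) t (restrict c S)
    restrict-iter P zero    S = refl
    restrict-iter P (suc t) S =
      trans (restrict-localStep P _) (cong (localStep P G) (restrict-iter P t S))

    restrict-converts : ∀ P S → Converts P (G ⊗ K₂) S → Converts P G (restrict c S)
    restrict-converts P S (t , conv) =
      t , trans (sym (restrict-iter P t S)) (trans (cong (restrict c) conv) (restrict-⊤ c))

  lift-converts : ∀ {c} → IsProperColouring G c →
                  ∀ P X → Converts P G X → Converts P (G ⊗ K₂) (lift X)
  lift-converts {c} proper P X (t , conv) =
    t , restrict-both-⊤⇒≡⊤ c _ (sheet-⊤ proper) (sheet-⊤ (IsProperColouring-not {c} proper))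
    where
    sheet-⊤ : ∀ {c′} → IsProperColouring G c′ →
              restrict c′ (iter (localStep P (G ⊗ K₂)) t (lift X)) ≡ ⊤
    sheet-⊤ {c′} proper′ = begin
      restrict c′ (iter (localStep P (G ⊗ K₂)) t (lift X))
        ≡⟨ restrict-iter proper′ P t (lift X) ⟩
      iter (localStep P G) t (restrict c′ (lift X))
        ≡⟨ cong (iter (localStep P G) t) (restrict-lift c′ X) ⟩
      iter (localStep P G) t X
        ≡⟨ conv ⟩
      ⊤ ∎

  minSize-⊗K₂ : ∀ {c} → IsProperColouring G c → ∀ P m →
                IsMinSize (Converts P G) m → IsMinSize (Converts P (G ⊗ K₂)) (2 * m)
  minSize-⊗K₂ {c} proper P m ((X , conv , ∣X∣≡m) , minimal) =
    (lift X , lift-converts proper P X conv , ∣lift-X∣) , lower-bound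
    where
    ∣lift-X∣ : ∣ lift X ∣ ≡ 2 * m
    ∣lift-X∣ = trans (∣lift∣ X) (trans (cong₂ _+_ ∣X∣≡m ∣X∣≡m) (n+n≡2*n m))
    lower-bound : ∀ S → Converts P (G ⊗ K₂) S → 2 * m ≤ ∣ S ∣
    lower-bound S convS = subst₂ _≤_ (n+n≡2*n m) (sym (∣p∣≡∣restrict∣+∣restrict-not∣ c S))
      (+-mono-≤ (minimal _ (restrict-converts proper P S convS))
                (minimal _ (restrict-converts (IsProperColouring-not {c} proper) P S convS)))

lemma3 : (G : Graph) → Connected G → Bipartite G → (k : ℕ) → 1 ≤ k →
         (∀ m → Min-k k G m → Min-k k (G ⊗ K₂) (2 * m)) ×
         (∀ m → Min-D G m → Min-D (G ⊗ K₂) (2 * m))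
lemma3 G _ (c , proper) k _ =
  minSize-⊗K₂ G proper (λ _ b → k ≤ᵇ b) ,
  minSize-⊗K₂ G proper (λ d b → (1 ≤ᵇ d) ∧ (d ≤ᵇ 2 * b))
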